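{- Let $I$ be an instance of Min BP that has an equivalent graph $G$. Then $\mathrm{OPT}(I)\ge \omega(G)$.
   Context: Min BP: an instance consists of a set $A=\{a_1,\ldots,a_n\}$ of $n$ items, each item $a_j$ having a positive rational size $s_j$, and $n$ bins. The task is to find $n$ pairwise disjoint (possibly empty) subsets $A_1,\ldots,A_n$ of $A$ with union $A$, such that the sum of sizes in each subset is at most $1$ and the number of non-empty subsets is minimized. $\mathrm{OPT}(I)$ denotes this minimum number. A Min BP instance $I$ and a graph $G=(V,E)$ are equivalent if there is a bijection $f:A\to V$ such that for every $A'\subseteq A$ the characteristic vector $(x_1,\ldots,x_n)$ of $A'$ satisfies $s_1x_1+\cdots+s_nx_n\le 1$ if and only if $f(A')$ is an independent set of $G$. $\omega(G)$ is the size of a largest clique of $G$. -}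

module Defs where

open import Data.Nat using (ℕ; _≤_)
open import Data.Fin using (Fin; _≟_)
open import Data.Fin.Subset using (Subset; _∈_; ∣_∣)
open import Data.Fin.Properties using (any?)
open import Data.Bool using (Bool; true; false; if_then_else_)
open import Data.Vec using (Vec; lookup; tabulate)
open import Data.Vec.Functional using ()
open import Data.Rational as ℚ using (ℚ; 0ℚ; 1ℚ)
open import Data.Product using (Σ; ∃; _×_; _,_)
open import Function.Bundles using (Inverse; _⇔_; _↔_)
open import Relation.Nullary using (¬_; ⌊_⌋)
open import Relation.Binary.PropositionalEquality using (_≡_; _≢_)
open import Level using (0ℓ; suc)

-- A Min BP instance with n items a_1..a_n (indexed by Fin n) and n bins.
record MinBP (n : ℕ) : Set where
  field
    size     : Fin n → ℚ
    size-pos : ∀ i → 0ℚ ℚ.< size i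

sumℚ : ∀ {k} → Vec ℚ k → ℚ
sumℚ Vec.[] = 0ℚ
sumℚ (x Vec.∷ xs) = x ℚ.+ sumℚ xs

weight : ∀ {n} → MinBP n → Subset n → ℚ
weight I A′ = sumℚ (tabulate λ i → if lookup A′ i then MinBP.size I i else 0ℚ)

-- A packing: assignment of each item to one of the n bins
-- (equivalently n pairwise disjoint subsets A_1..A_n with union A).
Packing : ℕ → Set
Packing n = Fin n → Fin n

binContents : ∀ {n} → Packing n → Fin n → Subset n
binContents p b = tabulate λ i → ⌊ p i ≟ b ⌋

Feasible : ∀ {n} → MinBP n → Packing n → Set
Feasible I p = ∀ b → weight I (binContents p b) ℚ.≤ 1ℚ

usedBins : ∀ {n} → Packing n → ℕ
usedBins {n} p = ∣ (tabulate λ b → ⌊ any? (λ i → p i ≟ b) ⌋) ∣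

IsOPT : ∀ {n} → MinBP n → ℕ → Set
IsOPT I k = (Σ (Packing _) λ p → Feasible I p × usedBins p ≡ k)
          × (∀ p → Feasible I p → k ≤ usedBins p)

record Graph (m : ℕ) : Set₁ where
  field
    Adj     : Fin m → Fin m → Set
    sym     : ∀ {u v} → Adj u v → Adj v u
    irrefl  : ∀ {u} → ¬ Adj u u

Independent : ∀ {m} → Graph m → (Fin m → Set) → Set
Independent G P = ∀ u v → P u → P v → u ≢ v → ¬ Graph.Adj G u v

IsClique : ∀ {m} → Graph m → Subset m → Set
IsClique G C = ∀ u v → u ∈ C → v ∈ C → u ≢ v → Graph.Adj G u v

IsCliqueNumber : ∀ {m} → Graph m → ℕ → Set
IsCliqueNumber G w = (Σ (Subset _) λ C → IsClique G C × ∣ C ∣ ≡ w)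
                   × (∀ C → IsClique G C → ∣ C ∣ ≤ w)

Image : ∀ {n m} → (Fin n → Fin m) → Subset n → Fin m → Set
Image f A′ v = ∃ λ a → a ∈ A′ × f a ≡ v

EquivalentVia : ∀ {n m} → MinBP n → Graph m → Fin n ↔ Fin m → Set
EquivalentVia I G f = ∀ (A′ : Subset _) →
  (weight I A′ ℚ.≤ 1ℚ) ⇔ Independent G (Image (Inverse.to f) A′)

Equivalent : ∀ {n m} → MinBP n → Graph m → Set
Equivalent {n} {m} I G = Σ (Fin n ↔ Fin m) (EquivalentVia I G)

module Submission where

-- Fix an optimal feasible packing p and a maximum clique C of G, and let
-- g = f⁻¹ send vertices back to items.  Each bin of p has weight ≤ 1, so by
-- the equivalence its image under f is an independent set of G.  A clique
-- meets an independent set in at most one vertex, hence the map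
-- v ↦ p (g v) (the bin holding the item of v) is injective on C; it also
-- lands in the set of non-empty bins.  A pigeonhole lemma for subsets of
-- Fin then gives ω(G) = ∣ C ∣ ≤ usedBins p = OPT(I).

open import Defs
open import Data.Nat using (ℕ; _≤_; z≤n; s≤s)
open import Data.Nat.Properties using (≤-trans)
open import Data.Fin using (Fin; zero; suc; _≟_)
open import Data.Fin.Properties using (any?; suc-injective; 0≢1+n)
open import Data.Fin.Subset using (Subset; _∈_; ∣_∣; inside; outside; _-_)
open import Data.Fin.Subset.Properties using (x∈p∧x≢y⇒x∈p-y; x∈p⇒∣p-x∣<∣p∣)
open import Data.Vec using (_∷_; []; here; there; tabulate)
open import Data.Vec.Properties using (lookup⇒[]=; lookup∘tabulate)
open import Data.Bool.Properties using (T-≡)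
open import Data.Product using (_,_)
open import Function.Bundles using (Inverse; Equivalence; _↔_)
open import Relation.Nullary using (Dec; yes; no; ⌊_⌋; contradiction)
open import Relation.Nullary.Decidable using (fromWitness)
open import Relation.Binary.PropositionalEquality using (_≡_; refl; sym; trans; subst₂)

-- Induction on C; when the first
-- element is in C, its image is removed from U for the recursive call.
injectiveOn⇒∣∣≤ : ∀ {m k} (C : Subset m) (U : Subset k) (h : Fin m → Fin k) →
                  (∀ x → x ∈ C → h x ∈ U) →
                  (∀ x y → x ∈ C → y ∈ C → h x ≡ h y → x ≡ y) →
                  ∣ C ∣ ≤ ∣ U ∣
injectiveOn⇒∣∣≤ [] U h into inj = z≤n
injectiveOn⇒∣∣≤ (outside ∷ C) U h into inj =
  injectiveOn⇒∣∣≤ C U (λ x → h (suc x))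
    (λ x x∈C → into (suc x) (there x∈C))
    (λ x y x∈C y∈C e → suc-injective (inj (suc x) (suc y) (there x∈C) (there y∈C) e))
injectiveOn⇒∣∣≤ (inside ∷ C) U h into inj =
  ≤-trans (s≤s ∣C∣≤∣U-h₀∣) (x∈p⇒∣p-x∣<∣p∣ (into zero here))
  where
  -- no later element of C shares the image of the first one
  ∣C∣≤∣U-h₀∣ : ∣ C ∣ ≤ ∣ U - h zero ∣
  ∣C∣≤∣U-h₀∣ = injectiveOn⇒∣∣≤ C (U - h zero) (λ x → h (suc x))
    (λ x x∈C → x∈p∧x≢y⇒x∈p-y (into (suc x) (there x∈C))
       (λ e → 0≢1+n (sym (inj (suc x) zero (there x∈C) here e))))
    (λ x y x∈C y∈C e → suc-injective (inj (suc x) (suc y) (there x∈C) (there y∈C) e))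

∈-tabulate-dec : ∀ {n} {P : Fin n → Set} (P? : ∀ i → Dec (P i)) i →
                 P i → i ∈ tabulate (λ j → ⌊ P? j ⌋)
∈-tabulate-dec P? i Pi =
  lookup⇒[]= i _ (trans (lookup∘tabulate _ i) (Equivalence.to T-≡ (fromWitness Pi)))

∈-binContents : ∀ {n} (p : Packing n) i → i ∈ binContents p (p i)
∈-binContents p i = ∈-tabulate-dec (λ j → p j ≟ p i) i refl

UsedBins : ∀ {n} → Packing n → Subset n
UsedBins p = tabulate λ b → ⌊ any? (λ i → p i ≟ b) ⌋

bin∈UsedBins : ∀ {n} (p : Packing n) i → p i ∈ UsedBins p
bin∈UsedBins p i = ∈-tabulate-dec (λ b → any? (λ j → p j ≟ b)) (p i) (i , refl)

bin-independent : ∀ {n m} (I : MinBP n) (G : Graph m) (f : Fin n ↔ Fin m) →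
                  EquivalentVia I G f → ∀ {p} → Feasible I p → ∀ b →
                  Independent G (Image (Inverse.to f) (binContents p b))
bin-independent I G f equiv {p} feasible b =
  Equivalence.to (equiv (binContents p b)) (feasible b)

clique∩independent-unique : ∀ {m} (G : Graph m) {C P} → IsClique G C →
                            Independent G P → ∀ u v → u ∈ C → v ∈ C →
                            P u → P v → u ≡ v
clique∩independent-unique G clique indep u v u∈C v∈C Pu Pv with u ≟ v
... | yes u≡v = u≡v
... | no u≢v  = contradiction (clique u v u∈C v∈C u≢v) (indep u v Pu Pv u≢v)

-- Every feasible packing of I uses at least as many bins as any clique of G
-- has vertices: sending a vertex to the bin of its item is injective on a clique.
clique≤usedBins : ∀ {n m} (I : MinBP n) (G : Graph m) (f : Fin n ↔ Fin m) →
                  EquivalentVia I G f → ∀ {p} → Feasible I p →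
                  ∀ {C} → IsClique G C → ∣ C ∣ ≤ usedBins p
clique≤usedBins I G f equiv {p} feasible {C} clique =
  injectiveOn⇒∣∣≤ C (UsedBins p) binOf (λ v _ → bin∈UsedBins p (item v)) sameBin⇒equal
  where
  item : Fin _ → Fin _
  item = Inverse.from f

  binOf : Fin _ → Fin _
  binOf v = p (item v)

  inImage : ∀ v b → binOf v ≡ b → Image (Inverse.to f) (binContents p b) v
  inImage v b refl = item v , ∈-binContents p (item v) , Inverse.strictlyInverseˡ f v

  sameBin⇒equal : ∀ u v → u ∈ C → v ∈ C → binOf u ≡ binOf v → u ≡ v
  sameBin⇒equal u v u∈C v∈C sameBin =
    clique∩independent-unique G clique (bin-independent I G f equiv feasible (binOf u))
      u v u∈C v∈C (inImage u (binOf u) refl) (inImage v (binOf u) (sym sameBin))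

theorem3p35 : ∀ {n m} (I : MinBP n) (G : Graph m) → Equivalent I G →
              ∀ (opt ω : ℕ) → IsOPT I opt → IsCliqueNumber G ω → ω ≤ opt
theorem3p35 I G (f , equiv) opt ω ((p , feasible , used≡opt) , _) ((C , clique , ∣C∣≡ω) , _) =
  subst₂ _≤_ ∣C∣≡ω used≡opt (clique≤usedBins I G f equiv feasible clique)
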